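{- Let $n\ge 2$ and $k\ge1$ be integers. Then $$\sum_{l=1}^{n-2}S(k,l)+\sum_{l=1}^{n-1}l^2\,S(k,l)+(n-1)^2\,S(k,n)=m^{(n-1,1)}_{(n-1,1)}(k).$$
   Context: $S(k,l)$ denotes the Stirling number of the second kind, the number of partitions of a $k$-element set into $l$ blocks. Partitions are identified with their Ferrers diagrams and ordered by containment $\subseteq$. For a positive integer $K$ and partitions $\lambda,\mu$, a vacillating tableau of length $K$ from $\lambda$ to $\mu$ is a sequence of partitions $\lambda=\lambda^0\supset\lambda^1\subset\lambda^2\supset\cdots\supset\lambda^{2K-1}\subset\lambda^{2K}=\mu$ in which $\lambda^i$ and $\lambda^{i+1}$ differ by exactly one cell for all $i$. The number of such vacillating tableaux is denoted $m^\lambda_\mu(K)$. -}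

module Defs where

open import Data.Nat using (ℕ; zero; suc; _+_; _*_; _∸_; _≤_; _≥_; _<_; z≤n; s≤s)
open import Data.List using (List; []; _∷_)
open import Data.Nat.ListAction using (sum)
open import Data.List.Relation.Unary.All using (All)
open import Data.List.Relation.Unary.Linked using (Linked)
open import Data.Product using (Σ; _×_; _,_; proj₁)
open import Relation.Binary.PropositionalEquality using (_≡_)

S : ℕ → ℕ → ℕ
S zero    zero    = 1
S zero    (suc l) = 0
S (suc k) zero    = 0
S (suc k) (suc l) = suc l * S k (suc l) + S k l

sum1to : ℕ → (ℕ → ℕ) → ℕ
sum1to zero    f = 0
sum1to (suc n) f = sum1to n f + f (suc n)

IsPartition : List ℕ → Set
IsPartition xs = Linked _≥_ xs × All (λ x → 0 < x) xs

Partition : Set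
Partition = Σ (List ℕ) IsPartition

size : Partition → ℕ
size p = sum (proj₁ p)

-- containment of row lists (missing rows count as 0)
data _⊑_ : List ℕ → List ℕ → Set where
  []⊑ : ∀ {ys} → [] ⊑ ys
  ∷⊑  : ∀ {x y xs ys} → x ≤ y → xs ⊑ ys → (x ∷ xs) ⊑ (y ∷ ys)

_⊆ₚ_ : Partition → Partition → Set
p ⊆ₚ q = proj₁ p ⊑ proj₁ q

_⋖_ : Partition → Partition → Set
p ⋖ q = (p ⊆ₚ q) × (size q ≡ suc (size p))

-- Vacillating tableaux of length K from λ to μ:
-- λ = λ⁰ ⊃ λ¹ ⊂ λ² ⊃ ⋯ ⊃ λ^{2K-1} ⊂ λ^{2K} = μ, consecutive ones differing by one cell.
VT : ℕ → Partition → Partition → Set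
VT zero    p q = p ≡ q
VT (suc K) p q = Σ Partition (λ p₁ → Σ Partition (λ p₂ → (p₁ ⋖ p) × (p₁ ⋖ p₂) × VT K p₂ q))

hook : (n : ℕ) → 2 ≤ n → Partition
hook (suc (suc m)) (s≤s (s≤s z≤n)) =
  (suc m ∷ 1 ∷ []) , (Linked._∷_ (s≤s z≤n) (Linked.[-]) , All._∷_ (s≤s z≤n) (All._∷_ (s≤s z≤n) All.[]))

lhs : ℕ → ℕ → ℕ
lhs n k = sum1to (n ∸ 2) (S k) + sum1to (n ∸ 1) (λ l → l * l * S k l) + (n ∸ 1) * (n ∸ 1) * S k n

-- Vacillating tableaux of length k are walks in Young's lattice along the word (DU)ᵏ, D removing and
-- U adding a cell.  Young's lattice is 1-differential: two distinct partitions have at most one common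
-- upper cover (their union) and at most one common lower cover (their intersection), and one exists
-- iff the other does; and a partition has exactly one more addable than removable cell.  Bijectively,
-- UD = DU + I.  From a one-row partition (m+1) the first step down and the last step up are forced, so
-- normal ordering the remaining (UD)ᵏ from (m) to itself gives ∑_{l ≤ m+1} S(k+1,l) walks, by the
-- Stirling recurrence.  In a walk from (n) to itself the last down-up step passes through (n-1), whose
-- upper covers are (n) and (n-1,1); cancelling the walks already counted yields the walks from (n) to
-- (n-1,1), and the same step one level further yields those from (n-1,1) to itself.  The recurrence
-- S(k+1,l) = l S(k,l) + S(k,l-1) turns the resulting counts into the stated sums.

module Submission where

open import Algebra.Properties.CommutativeSemigroup using (interchange)
open import Axiom.UniquenessOfIdentityProofs using (UIP; module Decidable⇒UIP)
open import Data.Empty using (⊥-elim)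
open import Data.Fin using (Fin)
open import Data.Fin.Properties using (+↔⊎; 1↔⊤)
open import Data.List using (List; []; _∷_; _++_)
open import Data.List.Properties as List using (++-identityʳ)
open import Data.List.Relation.Unary.All as All using (All; []; _∷_)
open import Data.List.Relation.Unary.Linked as Linked using ([]; [-]; _∷_)
open import Data.Nat using (ℕ; zero; suc; _+_; _*_; _≤_; _<_; _⊔_; _⊓_; z≤n; s≤s; _≟_)
open import Data.Nat.ListAction using (sum)
open import Data.Nat.Properties
open import Data.Nat.Tactic.RingSolver using (solve-∀)
open import Data.Product using (Σ; _×_; _,_; proj₁; proj₂)
open import Data.Product.Function.Dependent.Propositional using () renaming (congˡ to Σ-congˡ)
open import Data.Product.Function.NonDependent.Propositional using (_×-↔_)
open import Data.Product.Properties using (≡-dec)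
open import Data.Sum using (_⊎_; inj₁; inj₂)
open import Data.Sum.Function.Propositional using (_⊎-↔_)
open import Data.Unit using (⊤; tt)
open import Defs
open import Function.Bundles using (_↔_; mk↔ₛ′; Inverse)
open import Function.Properties.Inverse using (↔-refl; ↔-sym; ↔-trans)
open import Function.Related.Propositional using (module EquationalReasoning; bijection)
open import Function.Related.TypeIsomorphisms
  using (×-comm; ⊎-comm; Σ-assoc; Σ-distribˡ-⊎; ×-distribˡ-⊎; ×-distribʳ-⊎)
open import Relation.Binary.PropositionalEquality
open import Relation.Nullary using (Dec; yes; no)
open import Relation.Nullary.Irrelevant using (Irrelevant)

private variable
  A B : Set

×-irrelevant : {P Q : Set} → Irrelevant P → Irrelevant Q → Irrelevant (P × Q)
×-irrelevant irrP irrQ (p , q) (p′ , q′) = cong₂ _,_ (irrP p p′) (irrQ q q′)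

Σ-≡-irrelevant : {P : A → Set} → (∀ x → Irrelevant (P x)) → {u v : Σ A P} → proj₁ u ≡ proj₁ v → u ≡ v
Σ-≡-irrelevant irr {x , p} {.x , q} refl = cong (x ,_) (irr x p q)

Irrelevant-↔ : Irrelevant A → Irrelevant B → (A → B) → (B → A) → A ↔ B
Irrelevant-↔ irrA irrB f g = mk↔ₛ′ f g (λ _ → irrB _ _) (λ _ → irrA _ _)

Σ-unique : {P X : A → Set} {a : A} → UIP A → (∀ x → Irrelevant (P x)) → (∀ x → P x → x ≡ a) → P a →
           Σ A (λ x → P x × X x) ↔ X a
Σ-unique {P = P} {X} {a} uip irr unique pa = mk↔ₛ′ to (λ x → a , pa , x) to-from from-to
  where
  to : Σ _ (λ x → P x × X x) → X a
  to (x , px , y) = subst X (unique x px) y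
  to-from : ∀ y → to (a , pa , y) ≡ y
  to-from y = cong (λ e → subst X e y) (uip (unique a pa) refl)
  from-to : ∀ z → (a , pa , to z) ≡ z
  from-to (x , px , y) = lemma (unique x px)
    where
    lemma : (e : x ≡ a) → (a , pa , subst X e y) ≡ (x , px , y)
    lemma refl = cong (λ p → a , p , y) (irr a pa px)

Σ-reassoc : {C : Set} {P : A → Set} {Q : A → C → Set} {R : C → Set} →
            Σ A (λ a → P a × Σ C (λ c → Q a c × R c)) ↔ Σ C (λ c → Σ A (λ a → P a × Q a c) × R c)
Σ-reassoc = mk↔ₛ′ (λ (a , pa , c , qac , rc) → c , (a , pa , qac) , rc)
                  (λ (c , (a , pa , qac) , rc) → a , pa , c , qac , rc)
                  (λ _ → refl) (λ _ → refl)

choose : (u v : B ⊎ ⊤) → u ≢ v → B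
choose (inj₁ b) _        _   = b
choose (inj₂ _) (inj₁ b) _   = b
choose (inj₂ _) (inj₂ _) u≢v = ⊥-elim (u≢v refl)

choose-inj₁ : ∀ {u v : B ⊎ ⊤} {b} (u≢v : u ≢ v) → u ≡ inj₁ b → choose u v u≢v ≡ b
choose-inj₁ _ refl = refl

choose-inj₂ : ∀ {u v : B ⊎ ⊤} {b} (u≢v : u ≢ v) → u ≡ inj₂ tt → v ≡ inj₁ b → choose u v u≢v ≡ b
choose-inj₂ _ refl refl = refl

to-inj₁≢to-inj₂ : (f : (A ⊎ ⊤) ↔ (B ⊎ ⊤)) → ∀ a → Inverse.to f (inj₁ a) ≢ Inverse.to f (inj₂ tt)
to-inj₁≢to-inj₂ f a e with trans (sym (strictlyInverseʳ (inj₁ a))) (inverseʳ e)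
  where open Inverse f
... | ()

-- f on A, except that the element sent to the extra point is sent where the extra point goes
restrict : (A ⊎ ⊤) ↔ (B ⊎ ⊤) → A → B
restrict f a = choose (Inverse.to f (inj₁ a)) (Inverse.to f (inj₂ tt)) (to-inj₁≢to-inj₂ f a)

restrict-inverse : (f : (A ⊎ ⊤) ↔ (B ⊎ ⊤)) → ∀ a → restrict (↔-sym f) (restrict f a) ≡ a
restrict-inverse f a = by-image (to (inj₁ a)) refl
  where
  open Inverse f
  open ≡-Reasoning
  by-image : ∀ u → to (inj₁ a) ≡ u → restrict (↔-sym f) (restrict f a) ≡ a
  by-image (inj₁ b) e = begin
    restrict (↔-sym f) (restrict f a)  ≡⟨ cong (restrict (↔-sym f)) (choose-inj₁ _ e) ⟩
    restrict (↔-sym f) b               ≡⟨ choose-inj₁ _ (inverseʳ (sym e)) ⟩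
    a                                  ∎
  by-image (inj₂ tt) e = by-image-of-extra (to (inj₂ tt)) refl
    where
    by-image-of-extra : ∀ v → to (inj₂ tt) ≡ v → restrict (↔-sym f) (restrict f a) ≡ a
    by-image-of-extra (inj₁ c) e′ = begin
      restrict (↔-sym f) (restrict f a)  ≡⟨ cong (restrict (↔-sym f)) (choose-inj₂ _ e e′) ⟩
      restrict (↔-sym f) c               ≡⟨ choose-inj₂ _ (inverseʳ (sym e′)) (inverseʳ (sym e)) ⟩
      a                                  ∎
    by-image-of-extra (inj₂ tt) e′ = ⊥-elim (to-inj₁≢to-inj₂ f a (trans e (sym e′)))

⊎-cancelʳ-⊤ : (A ⊎ ⊤) ↔ (B ⊎ ⊤) → A ↔ B
⊎-cancelʳ-⊤ f = mk↔ₛ′ (restrict f) (restrict (↔-sym f)) (restrict-inverse (↔-sym f)) (restrict-inverse f)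

Fin0-⊎ : (Fin 0 ⊎ A) ↔ A
Fin0-⊎ = mk↔ₛ′ (λ { (inj₂ a) → a ; (inj₁ ()) }) inj₂ (λ _ → refl) (λ { (inj₂ _) → refl ; (inj₁ ()) })

Finsuc-⊎ : ∀ {n} → (Fin (suc n) ⊎ A) ↔ ((Fin n ⊎ A) ⊎ ⊤)
Finsuc-⊎ = mk↔ₛ′
  (λ { (inj₁ Fin.zero) → inj₂ tt ; (inj₁ (Fin.suc i)) → inj₁ (inj₁ i) ; (inj₂ a) → inj₁ (inj₂ a) })
  (λ { (inj₂ tt) → inj₁ Fin.zero ; (inj₁ (inj₁ i)) → inj₁ (Fin.suc i) ; (inj₁ (inj₂ a)) → inj₂ a })
  (λ { (inj₂ tt) → refl ; (inj₁ (inj₁ _)) → refl ; (inj₁ (inj₂ _)) → refl })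
  (λ { (inj₁ Fin.zero) → refl ; (inj₁ (Fin.suc _)) → refl ; (inj₂ _) → refl })

⊎-cancelˡ-Fin : ∀ n → (Fin n ⊎ A) ↔ (Fin n ⊎ B) → A ↔ B
⊎-cancelˡ-Fin zero    f = ↔-trans (↔-sym Fin0-⊎) (↔-trans f Fin0-⊎)
⊎-cancelˡ-Fin (suc n) f = ⊎-cancelˡ-Fin n (⊎-cancelʳ-⊤ (↔-trans (↔-sym Finsuc-⊎) (↔-trans f Finsuc-⊎)))

Fin-+-cancelˡ : ∀ m n → (Fin m ⊎ A) ↔ Fin (m + n) → A ↔ Fin n
Fin-+-cancelˡ m n f = ⊎-cancelˡ-Fin m (↔-trans f +↔⊎)

-- Partitions and covers in Young's lattice

firstRow : List ℕ → ℕ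
firstRow []      = 0
firstRow (x ∷ _) = x

isPartition-∷ : ∀ {x xs} → 0 < x → firstRow xs ≤ x → IsPartition xs → IsPartition (x ∷ xs)
isPartition-∷ {xs = []}    x>0 _   _            = [-] , x>0 ∷ []
isPartition-∷ {xs = _ ∷ _} x>0 x≥y (ys↘ , ys>0) = (x≥y ∷ ys↘) , (x>0 ∷ ys>0)

isPartition-tail : ∀ {x xs} → IsPartition (x ∷ xs) → IsPartition xs
isPartition-tail {xs = []}    _                        = [] , []
isPartition-tail {xs = _ ∷ _} ((_ ∷ ys↘) , (_ ∷ ys>0)) = ys↘ , ys>0

isPartition-head>0 : ∀ {x xs} → IsPartition (x ∷ xs) → 0 < x
isPartition-head>0 (_ , x>0 ∷ _) = x>0

isPartition-head≥ : ∀ {x xs} → IsPartition (x ∷ xs) → firstRow xs ≤ x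
isPartition-head≥ {xs = []}    _               = z≤n
isPartition-head≥ {xs = _ ∷ _} ((x≥y ∷ _) , _) = x≥y

IsPartition-irrelevant : ∀ {xs} → Irrelevant (IsPartition xs)
IsPartition-irrelevant = ×-irrelevant (Linked.irrelevant ≤-irrelevant) (All.irrelevant ≤-irrelevant)

Partition-≡ : {p q : Partition} → proj₁ p ≡ proj₁ q → p ≡ q
Partition-≡ = Σ-≡-irrelevant (λ _ → IsPartition-irrelevant)

_≟ₚ_ : (p q : Partition) → Dec (p ≡ q)
_≟ₚ_ = ≡-dec (List.≡-dec _≟_) (λ p q → yes (IsPartition-irrelevant p q))

Partition-UIP : UIP Partition
Partition-UIP = Decidable⇒UIP.≡-irrelevant _≟ₚ_

positive : (p : Partition) → All (0 <_) (proj₁ p)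
positive p = proj₂ (proj₂ p)

infix 4 _⋖ʳ_ _⋖ₚ_

data _⋖ʳ_ : List ℕ → List ℕ → Set where
  here    : ∀ {x xs} → x ∷ xs ⋖ʳ suc x ∷ xs
  new-row : [] ⋖ʳ 1 ∷ []
  there   : ∀ {x xs ys} → xs ⋖ʳ ys → x ∷ xs ⋖ʳ x ∷ ys

_⋖ₚ_ : Partition → Partition → Set
p ⋖ₚ q = proj₁ p ⋖ʳ proj₁ q

⋖ʳ-irrelevant : ∀ {xs ys} → Irrelevant (xs ⋖ʳ ys)
⋖ʳ-irrelevant here      here       = refl
⋖ʳ-irrelevant new-row   new-row    = refl
⋖ʳ-irrelevant (there c) (there c′) = cong there (⋖ʳ-irrelevant c c′)

⊑-refl : ∀ {xs} → xs ⊑ xs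
⊑-refl {[]}    = []⊑
⊑-refl {_ ∷ _} = ∷⊑ ≤-refl ⊑-refl

⋖ʳ⇒⊑ : ∀ {xs ys} → xs ⋖ʳ ys → xs ⊑ ys
⋖ʳ⇒⊑ here      = ∷⊑ (n≤1+n _) ⊑-refl
⋖ʳ⇒⊑ new-row   = []⊑
⋖ʳ⇒⊑ (there c) = ∷⊑ ≤-refl (⋖ʳ⇒⊑ c)

⋖ʳ⇒sum : ∀ {xs ys} → xs ⋖ʳ ys → sum ys ≡ suc (sum xs)
⋖ʳ⇒sum here               = refl
⋖ʳ⇒sum new-row            = refl
⋖ʳ⇒sum {x ∷ xs} (there c) = trans (cong (x +_) (⋖ʳ⇒sum c)) (+-suc x (sum xs))

sum-mono-⊑ : ∀ {xs ys} → xs ⊑ ys → sum xs ≤ sum ys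
sum-mono-⊑ []⊑            = z≤n
sum-mono-⊑ (∷⊑ x≤y xs⊑ys) = +-mono-≤ x≤y (sum-mono-⊑ xs⊑ys)

+-squeeze : ∀ {a b c d} → a ≤ b → c ≤ d → b + d ≡ a + c → a ≡ b × c ≡ d
+-squeeze {a} {b} {c} {d} a≤b c≤d e = a≡b , +-cancelˡ-≡ b c d (trans (cong (_+ c) (sym a≡b)) (sym e))
  where
  a≡b : a ≡ b
  a≡b = ≤-antisym a≤b (+-cancelʳ-≤ c b a (≤-trans (+-monoʳ-≤ b c≤d) (≤-reflexive e)))

⊑-sum-≡ : ∀ {xs ys} → All (0 <_) ys → xs ⊑ ys → sum xs ≡ sum ys → xs ≡ ys
⊑-sum-≡ []          []⊑ _ = refl
⊑-sum-≡ (s≤s _ ∷ _) []⊑ ()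
⊑-sum-≡ (_ ∷ ys>0) (∷⊑ x≤y xs⊑ys) e with +-squeeze x≤y (sum-mono-⊑ xs⊑ys) (sym e)
... | refl , e′ = cong (_ ∷_) (⊑-sum-≡ ys>0 xs⊑ys e′)

⊑-sum-suc⇒⋖ʳ : ∀ {xs ys} → All (0 <_) ys → xs ⊑ ys → sum ys ≡ suc (sum xs) → xs ⋖ʳ ys
⊑-sum-suc⇒⋖ʳ {ys = []}        _          _   ()
⊑-sum-suc⇒⋖ʳ {ys = suc y ∷ ys} (_ ∷ ys>0) []⊑ e with +-squeeze (z≤n {y}) (z≤n {sum ys}) (suc-injective e)
... | refl , e′ with ⊑-sum-≡ ys>0 []⊑ e′
... | refl = new-row
⊑-sum-suc⇒⋖ʳ {x ∷ xs} {y ∷ ys} (_ ∷ ys>0) (∷⊑ x≤y xs⊑ys) e with x ≟ y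
... | yes refl = there (⊑-sum-suc⇒⋖ʳ ys>0 xs⊑ys (+-cancelˡ-≡ x _ _ (trans e (sym (+-suc x (sum xs))))))
... | no x≢y with +-squeeze (≤∧≢⇒< x≤y x≢y) (sum-mono-⊑ xs⊑ys) e
...   | refl , e′ with ⊑-sum-≡ ys>0 xs⊑ys e′
...     | refl = here

⋖↔⋖ₚ : ∀ {p q} → (p ⋖ q) ↔ (p ⋖ₚ q)
⋖↔⋖ₚ {p} {q} = Irrelevant-↔
  (×-irrelevant ⊑-irrelevant ≡-irrelevant) ⋖ʳ-irrelevant
  (λ (p⊑q , e) → ⊑-sum-suc⇒⋖ʳ (positive q) p⊑q e) (λ c → ⋖ʳ⇒⊑ c , ⋖ʳ⇒sum c)
  where
  ⊑-irrelevant : ∀ {xs ys} → Irrelevant (xs ⊑ ys)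
  ⊑-irrelevant []⊑ []⊑ = refl
  ⊑-irrelevant (∷⊑ a l) (∷⊑ b l′) = cong₂ ∷⊑ (≤-irrelevant a b) (⊑-irrelevant l l′)

Σ-≡-contract : ∀ {p} {X : Partition → Set} → Σ Partition (λ r → p ≡ r × X r) ↔ X p
Σ-≡-contract = Σ-unique Partition-UIP (λ _ → Partition-UIP) (λ _ e → sym e) refl

infixr 6 _∪_ _∩_

_∪_ : List ℕ → List ℕ → List ℕ
[]       ∪ ys       = ys
(x ∷ xs) ∪ []       = x ∷ xs
(x ∷ xs) ∪ (y ∷ ys) = x ⊔ y ∷ xs ∪ ys

_∩_ : List ℕ → List ℕ → List ℕ
[]       ∩ _        = []
(_ ∷ _)  ∩ []       = []
(x ∷ xs) ∩ (y ∷ ys) = x ⊓ y ∷ xs ∩ ys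

⊑⇒∪≡ʳ : ∀ {xs ys} → xs ⊑ ys → xs ∪ ys ≡ ys
⊑⇒∪≡ʳ []⊑            = refl
⊑⇒∪≡ʳ (∷⊑ x≤y xs⊑ys) = cong₂ _∷_ (m≤n⇒m⊔n≡n x≤y) (⊑⇒∪≡ʳ xs⊑ys)

⊑⇒∪≡ˡ : ∀ {xs ys} → ys ⊑ xs → xs ∪ ys ≡ xs
⊑⇒∪≡ˡ {[]}    []⊑            = refl
⊑⇒∪≡ˡ {_ ∷ _} []⊑            = refl
⊑⇒∪≡ˡ         (∷⊑ y≤x ys⊑xs) = cong₂ _∷_ (m≥n⇒m⊔n≡m y≤x) (⊑⇒∪≡ˡ ys⊑xs)

⊑⇒∩≡ˡ : ∀ {xs ys} → xs ⊑ ys → xs ∩ ys ≡ xs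
⊑⇒∩≡ˡ []⊑            = refl
⊑⇒∩≡ˡ (∷⊑ x≤y xs⊑ys) = cong₂ _∷_ (m≤n⇒m⊓n≡m x≤y) (⊑⇒∩≡ˡ xs⊑ys)

⊑⇒∩≡ʳ : ∀ {xs ys} → ys ⊑ xs → xs ∩ ys ≡ ys
⊑⇒∩≡ʳ {[]}    []⊑            = refl
⊑⇒∩≡ʳ {_ ∷ _} []⊑            = refl
⊑⇒∩≡ʳ         (∷⊑ y≤x ys⊑xs) = cong₂ _∷_ (m≥n⇒m⊓n≡n y≤x) (⊑⇒∩≡ʳ ys⊑xs)

firstRow-∪ : ∀ xs ys → firstRow (xs ∪ ys) ≡ firstRow xs ⊔ firstRow ys
firstRow-∪ []      _       = refl
firstRow-∪ (x ∷ _) []      = sym (⊔-identityʳ x)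
firstRow-∪ (_ ∷ _) (_ ∷ _) = refl

firstRow-∩ : ∀ xs ys → firstRow (xs ∩ ys) ≡ firstRow xs ⊓ firstRow ys
firstRow-∩ []      _       = refl
firstRow-∩ (x ∷ _) []      = sym (⊓-zeroʳ x)
firstRow-∩ (_ ∷ _) (_ ∷ _) = refl

∪-isPartition : ∀ {xs ys} → IsPartition xs → IsPartition ys → IsPartition (xs ∪ ys)
∪-isPartition {[]}               _ Y = Y
∪-isPartition {_ ∷ _} {[]}       X _ = X
∪-isPartition {x ∷ xs} {y ∷ ys} X Y = isPartition-∷
  (≤-trans (isPartition-head>0 X) (m≤m⊔n x y))
  (subst (_≤ x ⊔ y) (sym (firstRow-∪ xs ys)) (⊔-mono-≤ (isPartition-head≥ X) (isPartition-head≥ Y)))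
  (∪-isPartition (isPartition-tail X) (isPartition-tail Y))

∩-isPartition : ∀ {xs ys} → IsPartition xs → IsPartition ys → IsPartition (xs ∩ ys)
∩-isPartition {[]}               _ _ = [] , []
∩-isPartition {_ ∷ _} {[]}       _ _ = [] , []
∩-isPartition {x ∷ xs} {y ∷ ys} X Y = isPartition-∷
  (⊓-glb (isPartition-head>0 X) (isPartition-head>0 Y))
  (subst (_≤ x ⊓ y) (sym (firstRow-∩ xs ys)) (⊓-mono-≤ (isPartition-head≥ X) (isPartition-head≥ Y)))
  (∩-isPartition (isPartition-tail X) (isPartition-tail Y))

∷-≢ : ∀ {x : ℕ} {xs ys : List ℕ} → x ∷ xs ≢ x ∷ ys → xs ≢ ys
∷-≢ x∷xs≢x∷ys refl = x∷xs≢x∷ys refl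

⋖ʳ-upper : ∀ {xs ys zs} → All (0 <_) xs → All (0 <_) ys → xs ⋖ʳ zs → ys ⋖ʳ zs → xs ≢ ys →
           zs ≡ xs ∪ ys × xs ∩ ys ⋖ʳ xs × xs ∩ ys ⋖ʳ ys
⋖ʳ-upper _ _ here    here    xs≢ys = ⊥-elim (xs≢ys refl)
⋖ʳ-upper _ _ new-row new-row xs≢ys = ⊥-elim (xs≢ys refl)
⋖ʳ-upper _ (() ∷ _) new-row here _
⋖ʳ-upper (() ∷ _) _ here new-row _
⋖ʳ-upper {x ∷ _} _ _ here (there d) _
  rewrite m≤n⇒m⊔n≡n (n≤1+n x) | m≤n⇒m⊓n≡m (n≤1+n x) | ⊑⇒∪≡ˡ (⋖ʳ⇒⊑ d) | ⊑⇒∩≡ʳ (⋖ʳ⇒⊑ d)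
  = refl , there d , here
⋖ʳ-upper {_ ∷ _} {x ∷ _} _ _ (there d) here _
  rewrite m≥n⇒m⊔n≡m (n≤1+n x) | m≥n⇒m⊓n≡n (n≤1+n x) | ⊑⇒∪≡ʳ (⋖ʳ⇒⊑ d) | ⊑⇒∩≡ˡ (⋖ʳ⇒⊑ d)
  = refl , here , there d
⋖ʳ-upper {x ∷ _} (_ ∷ X) (_ ∷ Y) (there d) (there d′) xs≢ys
  with ⋖ʳ-upper X Y d d′ (∷-≢ xs≢ys)
... | refl , c , c′ rewrite ⊔-idem x | ⊓-idem x = refl , there c , there c′

⋖ʳ-lower : ∀ {ts xs ys} → ts ⋖ʳ xs → ts ⋖ʳ ys → xs ≢ ys →
           ts ≡ xs ∩ ys × xs ⋖ʳ xs ∪ ys × ys ⋖ʳ xs ∪ ys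
⋖ʳ-lower here    here    xs≢ys = ⊥-elim (xs≢ys refl)
⋖ʳ-lower new-row new-row xs≢ys = ⊥-elim (xs≢ys refl)
⋖ʳ-lower {x ∷ _} here (there d) _
  rewrite m≥n⇒m⊓n≡n (n≤1+n x) | m≥n⇒m⊔n≡m (n≤1+n x) | ⊑⇒∩≡ˡ (⋖ʳ⇒⊑ d) | ⊑⇒∪≡ʳ (⋖ʳ⇒⊑ d)
  = refl , there d , here
⋖ʳ-lower {x ∷ _} (there d) here _
  rewrite m≤n⇒m⊓n≡m (n≤1+n x) | m≤n⇒m⊔n≡n (n≤1+n x) | ⊑⇒∩≡ʳ (⋖ʳ⇒⊑ d) | ⊑⇒∪≡ˡ (⋖ʳ⇒⊑ d)
  = refl , here , there d
⋖ʳ-lower {x ∷ _} (there d) (there d′) xs≢ys with ⋖ʳ-lower d d′ (∷-≢ xs≢ys)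
... | refl , c , c′ rewrite ⊔-idem x | ⊓-idem x = refl , there c , there c′

-- Young's lattice is differential

-- The bound b on the first row lets addable cells be counted row by row.
Addable : ℕ → List ℕ → Set
Addable b xs = Σ (List ℕ) λ ys → IsPartition ys × xs ⋖ʳ ys × firstRow ys ≤ b

Removable : List ℕ → Set
Removable xs = Σ (List ℕ) λ ys → IsPartition ys × ys ⋖ʳ xs

Addable-≡ : ∀ {b xs} {u v : Addable b xs} → proj₁ u ≡ proj₁ v → u ≡ v
Addable-≡ = Σ-≡-irrelevant (λ _ → ×-irrelevant IsPartition-irrelevant (×-irrelevant ⋖ʳ-irrelevant ≤-irrelevant))

Removable-≡ : ∀ {xs} {u v : Removable xs} → proj₁ u ≡ proj₁ v → u ≡ v
Removable-≡ = Σ-≡-irrelevant (λ _ → ×-irrelevant IsPartition-irrelevant ⋖ʳ-irrelevant)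

Addable-[] : ∀ {b} → Addable b [] ↔ (Removable [] ⊎ 0 < b)
Addable-[] = mk↔ₛ′ to from to-from from-to
  where
  to : Addable _ [] → Removable [] ⊎ 0 < _
  to (_ , _ , new-row , 1≤b) = inj₂ 1≤b
  from : Removable [] ⊎ 0 < _ → Addable _ []
  from (inj₁ (_ , _ , ()))
  from (inj₂ 1≤b) = 1 ∷ [] , isPartition-∷ (s≤s z≤n) z≤n ([] , []) , new-row , 1≤b
  to-from : ∀ y → to (from y) ≡ y
  to-from (inj₁ (_ , _ , ()))
  to-from (inj₂ _) = refl
  from-to : ∀ y → from (to y) ≡ y
  from-to (_ , _ , new-row , _) = Addable-≡ refl

Addable-∷ : ∀ {b x xs} → IsPartition (x ∷ xs) → x ≤ b → Addable b (x ∷ xs) ↔ (x < b ⊎ Addable x xs)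
Addable-∷ {b} {x} {xs} X x≤b = mk↔ₛ′ to from to-from from-to
  where
  to : Addable b (x ∷ xs) → x < b ⊎ Addable x xs
  to (_ , _ , here    , x<b) = inj₁ x<b
  to (_ , Y , there c , _)   = inj₂ (_ , isPartition-tail Y , c , isPartition-head≥ Y)
  from : x < b ⊎ Addable x xs → Addable b (x ∷ xs)
  from (inj₁ x<b) =
    suc x ∷ xs , isPartition-∷ (s≤s z≤n) (m≤n⇒m≤1+n (isPartition-head≥ X)) (isPartition-tail X) , here , x<b
  from (inj₂ (ys , Y , c , ys≤x)) = x ∷ ys , isPartition-∷ (isPartition-head>0 X) ys≤x Y , there c , x≤b
  to-from : ∀ y → to (from y) ≡ y
  to-from (inj₁ _) = refl
  to-from (inj₂ _) = cong inj₂ (Addable-≡ refl)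
  from-to : ∀ y → from (to y) ≡ y
  from-to (_ , _ , here    , _) = Addable-≡ refl
  from-to (_ , _ , there _ , _) = Addable-≡ refl

shrinkFirstRow : ∀ {x xs} → IsPartition (x ∷ xs) → firstRow xs < x → Removable (x ∷ xs)
shrinkFirstRow {suc zero}    {[]}    _                 _       = [] , ([] , []) , new-row
shrinkFirstRow {suc zero}    {_ ∷ _} (_ , _ ∷ s≤s _ ∷ _) (s≤s ())
shrinkFirstRow {suc (suc w)} {xs}    X                 (s≤s h) =
  suc w ∷ xs , isPartition-∷ (s≤s z≤n) h (isPartition-tail X) , here

unconsRemovable : ∀ {x xs} → Removable (x ∷ xs) → firstRow xs < x ⊎ Removable xs
unconsRemovable (_ , Y , here)    = inj₁ (s≤s (isPartition-head≥ Y))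
unconsRemovable (_ , _ , new-row) = inj₁ (s≤s z≤n)
unconsRemovable (_ , Y , there c) = inj₂ (_ , isPartition-tail Y , c)

unconsRemovable-shrinkFirstRow : ∀ {x xs} (X : IsPartition (x ∷ xs)) h →
                                 unconsRemovable (shrinkFirstRow X h) ≡ inj₁ h
unconsRemovable-shrinkFirstRow {suc zero}    {[]}    _ _ = cong inj₁ (≤-irrelevant _ _)
unconsRemovable-shrinkFirstRow {suc zero}    {_ ∷ _} (_ , _ ∷ s≤s _ ∷ _) (s≤s ())
unconsRemovable-shrinkFirstRow {suc (suc _)} {_}     _ (s≤s _) = cong inj₁ (≤-irrelevant _ _)

⋖ʳ-firstRow : ∀ {xs ys} → xs ⋖ʳ ys → firstRow ys ≤ suc (firstRow xs)
⋖ʳ-firstRow here      = ≤-refl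
⋖ʳ-firstRow new-row   = ≤-refl
⋖ʳ-firstRow (there _) = n≤1+n _

firstRow-mono : ∀ {xs ys} → xs ⊑ ys → firstRow xs ≤ firstRow ys
firstRow-mono []⊑        = z≤n
firstRow-mono (∷⊑ x≤y _) = x≤y

Removable-∷ : ∀ {x xs} → IsPartition (x ∷ xs) → Removable (x ∷ xs) ↔ (firstRow xs < x ⊎ Removable xs)
Removable-∷ {x} {xs} X = mk↔ₛ′ unconsRemovable from to-from from-to
  where
  from : firstRow xs < x ⊎ Removable xs → Removable (x ∷ xs)
  from (inj₁ h) = shrinkFirstRow X h
  from (inj₂ (ys , Y , c)) =
    x ∷ ys , isPartition-∷ (isPartition-head>0 X) (≤-trans (firstRow-mono (⋖ʳ⇒⊑ c)) (isPartition-head≥ X)) Y , there c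
  to-from : ∀ y → unconsRemovable (from y) ≡ y
  to-from (inj₁ h) = unconsRemovable-shrinkFirstRow X h
  to-from (inj₂ _) = cong inj₂ (Removable-≡ refl)
  from-to : ∀ y → from (unconsRemovable y) ≡ y
  from-to (_ , (_ , s≤s _ ∷ _) , here) = Removable-≡ refl
  from-to (_ , _ , new-row)           = Removable-≡ refl
  from-to (_ , _ , there _)           = Removable-≡ refl

Addable↔Removable⊎ : ∀ {b} xs → IsPartition xs → firstRow xs ≤ b → Addable b xs ↔ (Removable xs ⊎ firstRow xs < b)
Addable↔Removable⊎ []       _ _   = Addable-[]
Addable↔Removable⊎ {b} (x ∷ xs) X x≤b = begin
  Addable b (x ∷ xs)                          ↔⟨ Addable-∷ X x≤b ⟩
  (x < b ⊎ Addable x xs)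
    ↔⟨ ↔-refl ⊎-↔ Addable↔Removable⊎ xs (isPartition-tail X) (isPartition-head≥ X) ⟩
  (x < b ⊎ (Removable xs ⊎ firstRow xs < x))  ↔⟨ ⊎-comm _ _ ⟩
  ((Removable xs ⊎ firstRow xs < x) ⊎ x < b)  ↔⟨ ⊎-comm _ _ ⊎-↔ ↔-refl ⟩
  ((firstRow xs < x ⊎ Removable xs) ⊎ x < b)  ↔⟨ Removable-∷ X ⊎-↔ ↔-refl ⟨
  (Removable (x ∷ xs) ⊎ x < b)                ∎
  where open EquationalReasoning {k = bijection}

Upper Lower : Partition → Partition → Set
Upper p s = Σ Partition λ r → p ⋖ₚ r × s ⋖ₚ r
Lower p s = Σ Partition λ t → t ⋖ₚ p × t ⋖ₚ s

module _ {p s : Partition} (p≢s : p ≢ s) where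

  private
    rows≢ : proj₁ p ≢ proj₁ s
    rows≢ e = p≢s (Partition-≡ e)
    p>0 = positive p
    s>0 = positive s

  Upper-irrelevant : Irrelevant (Upper p s)
  Upper-irrelevant (_ , c , d) (_ , c′ , d′) =
    Σ-≡-irrelevant (λ _ → ×-irrelevant ⋖ʳ-irrelevant ⋖ʳ-irrelevant)
      (Partition-≡ (trans (proj₁ (⋖ʳ-upper p>0 s>0 c d rows≢)) (sym (proj₁ (⋖ʳ-upper p>0 s>0 c′ d′ rows≢)))))

  Lower-irrelevant : Irrelevant (Lower p s)
  Lower-irrelevant (_ , c , d) (_ , c′ , d′) =
    Σ-≡-irrelevant (λ _ → ×-irrelevant ⋖ʳ-irrelevant ⋖ʳ-irrelevant)
      (Partition-≡ (trans (proj₁ (⋖ʳ-lower c d rows≢)) (sym (proj₁ (⋖ʳ-lower c′ d′ rows≢)))))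

  Upper→Lower : Upper p s → Lower p s
  Upper→Lower (_ , c , d) = (_ , ∩-isPartition (proj₂ p) (proj₂ s)) , proj₂ (⋖ʳ-upper p>0 s>0 c d rows≢)

  Lower→Upper : Lower p s → Upper p s
  Lower→Upper (_ , c , d) = (_ , ∪-isPartition (proj₂ p) (proj₂ s)) , proj₂ (⋖ʳ-lower c d rows≢)

Upper-diagonal : ∀ p → Upper p p ↔ (Lower p p ⊎ p ≡ p)
Upper-diagonal p@(xs , X) = begin
  Upper p p                                         ↔⟨ Σ-congˡ (diagonal ⋖ʳ-irrelevant) ⟩
  Σ Partition (p ⋖ₚ_)                               ↔⟨ bounded ⟩
  Addable (suc (firstRow xs)) xs                    ↔⟨ Addable↔Removable⊎ xs X (n≤1+n _) ⟩
  (Removable xs ⊎ firstRow xs < suc (firstRow xs))  ↔⟨ lower ⊎-↔ ≡-refl ⟩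
  (Lower p p ⊎ p ≡ p)                               ∎
  where
  open EquationalReasoning {k = bijection}
  diagonal : {P : Set} → Irrelevant P → (P × P) ↔ P
  diagonal irr = Irrelevant-↔ (×-irrelevant irr irr) irr proj₁ (λ c → c , c)
  bounded : Σ Partition (p ⋖ₚ_) ↔ Addable (suc (firstRow xs)) xs
  bounded = ↔-trans Σ-assoc (Σ-congˡ (mk↔ₛ′ (λ (Y , c) → Y , c , ⋖ʳ-firstRow c) (λ (Y , c , _) → Y , c)
    (λ (_ , _ , _) → cong (λ b → _ , _ , b) (≤-irrelevant _ _)) (λ _ → refl)))
  ≡-refl : (firstRow xs < suc (firstRow xs)) ↔ (p ≡ p)
  ≡-refl = Irrelevant-↔ ≤-irrelevant Partition-UIP (λ _ → refl) (λ _ → ≤-refl)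
  lower : Removable xs ↔ Lower p p
  lower = ↔-trans (↔-sym Σ-assoc) (Σ-congˡ (↔-sym (diagonal ⋖ʳ-irrelevant)))

Upper↔Lower⊎≡ : ∀ p s → Upper p s ↔ (Lower p s ⊎ p ≡ s)
Upper↔Lower⊎≡ p s with p ≟ₚ s
... | yes refl = Upper-diagonal p
... | no p≢s = Irrelevant-↔ (Upper-irrelevant p≢s) irrelevant (λ u → inj₁ (Upper→Lower p≢s u)) from
  where
  irrelevant : Irrelevant (Lower p s ⊎ p ≡ s)
  irrelevant (inj₁ l)   (inj₁ l′)   = cong inj₁ (Lower-irrelevant p≢s l l′)
  irrelevant (inj₂ p≡s) _          = ⊥-elim (p≢s p≡s)
  irrelevant (inj₁ _)   (inj₂ p≡s) = ⊥-elim (p≢s p≡s)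
  from : Lower p s ⊎ p ≡ s → Upper p s
  from (inj₁ l)   = Lower→Upper p≢s l
  from (inj₂ p≡s) = ⊥-elim (p≢s p≡s)

-- Walks in Young's lattice

data Step : Set where
  down up : Step

Walk : List Step → Partition → Partition → Set
Walk []         p q = p ≡ q
Walk (down ∷ w) p q = Σ Partition λ t → t ⋖ₚ p × Walk w t q
Walk (up ∷ w)   p q = Σ Partition λ r → p ⋖ₚ r × Walk w r q

Walk-++ : ∀ w {v p q} → Walk (w ++ v) p q ↔ Σ Partition (λ r → Walk w p r × Walk v r q)
Walk-++ []         = ↔-sym Σ-≡-contract
Walk-++ (down ∷ w) = ↔-trans (Σ-congˡ (↔-refl ×-↔ Walk-++ w)) Σ-reassoc
Walk-++ (up ∷ w)   = ↔-trans (Σ-congˡ (↔-refl ×-↔ Walk-++ w)) Σ-reassoc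

Walk-++-⊎ : ∀ w {v v₁ v₂ p q} → (∀ r → Walk v r q ↔ (Walk v₁ r q ⊎ Walk v₂ r q)) →
            Walk (w ++ v) p q ↔ (Walk (w ++ v₁) p q ⊎ Walk (w ++ v₂) p q)
Walk-++-⊎ w {v} {v₁} {v₂} {p} {q} split = begin
  Walk (w ++ v) p q                                   ↔⟨ Walk-++ w ⟩
  Σ Partition (λ r → Walk w p r × Walk v r q)         ↔⟨ Σ-congˡ (↔-trans (↔-refl ×-↔ split _) ×-distribˡ-⊎) ⟩
  Σ Partition (λ r → Walk w p r × Walk v₁ r q ⊎ Walk w p r × Walk v₂ r q)
                                                      ↔⟨ Σ-distribˡ-⊎ ⟩
  (Σ Partition (λ r → Walk w p r × Walk v₁ r q) ⊎ Σ Partition (λ r → Walk w p r × Walk v₂ r q))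
                                                      ↔⟨ Walk-++ w ⊎-↔ Walk-++ w ⟨
  (Walk (w ++ v₁) p q ⊎ Walk (w ++ v₂) p q)           ∎
  where open EquationalReasoning {k = bijection}

Walk-up-down : ∀ w {p q} → Walk (up ∷ down ∷ w) p q ↔ (Walk (down ∷ up ∷ w) p q ⊎ Walk w p q)
Walk-up-down w {p} {q} = begin
  Walk (up ∷ down ∷ w) p q                                          ↔⟨ Σ-reassoc ⟩
  Σ Partition (λ s → Upper p s × Walk w s q)                        ↔⟨ Σ-congˡ (Upper↔Lower⊎≡ p _ ×-↔ ↔-refl) ⟩
  Σ Partition (λ s → (Lower p s ⊎ p ≡ s) × Walk w s q)              ↔⟨ Σ-congˡ ×-distribʳ-⊎ ⟩
  Σ Partition (λ s → Lower p s × Walk w s q ⊎ p ≡ s × Walk w s q)   ↔⟨ Σ-distribˡ-⊎ ⟩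
  (Σ Partition (λ s → Lower p s × Walk w s q) ⊎ Σ Partition (λ s → p ≡ s × Walk w s q))
                                                                    ↔⟨ ↔-sym Σ-reassoc ⊎-↔ Σ-≡-contract ⟩
  (Walk (down ∷ up ∷ w) p q ⊎ Walk w p q)                           ∎
  where open EquationalReasoning {k = bijection}

downUp upDown : ℕ → List Step
downUp zero    = []
downUp (suc k) = down ∷ up ∷ downUp k
upDown zero    = []
upDown (suc k) = up ∷ down ∷ upDown k

downUp-++ : ∀ i w → downUp i ++ down ∷ up ∷ w ≡ down ∷ up ∷ downUp i ++ w
downUp-++ zero    w = refl
downUp-++ (suc i) w = cong (λ v → down ∷ up ∷ v) (downUp-++ i w)

upDown-++-up : ∀ k → upDown k ++ up ∷ [] ≡ up ∷ downUp k
upDown-++-up zero    = refl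
upDown-++-up (suc k) = cong (λ v → up ∷ down ∷ v) (upDown-++-up k)

VT↔Walk : ∀ k {p q} → VT k p q ↔ Walk (downUp k) p q
VT↔Walk zero    = ↔-refl
VT↔Walk (suc k) {p} = Σ-congˡ λ {p₁} →
  ↔-trans (Σ-congˡ λ {p₂} → ⋖↔⋖ₚ {p₁} {p} ×-↔ ⋖↔⋖ₚ {p₁} {p₂} ×-↔ VT↔Walk k) pull
  where
  pull : {P : Set} {Q R : Partition → Set} → Σ Partition (λ r → P × Q r × R r) ↔ (P × Σ Partition (λ r → Q r × R r))
  pull = mk↔ₛ′ (λ (r , p , qr , rr) → p , r , qr , rr) (λ (p , r , qr , rr) → r , p , qr , rr)
               (λ _ → refl) (λ _ → refl)

-- binomialTransform b j i = ∑ᵣ C(j,r) b(i+r)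
binomialTransform : (ℕ → ℕ) → ℕ → ℕ → ℕ
binomialTransform b zero    i = b i
binomialTransform b (suc j) i = binomialTransform b j (suc i) + binomialTransform b j i

Walk-normalOrder : ∀ {p q} (b : ℕ → ℕ) → (∀ i → Walk (downUp i) p q ↔ Fin (b i)) →
                   ∀ j i → Walk (downUp i ++ upDown j) p q ↔ Fin (binomialTransform b j i)
Walk-normalOrder {p} {q} b count zero i = subst (λ w → Walk w p q ↔ Fin (b i)) (sym (++-identityʳ (downUp i))) (count i)
Walk-normalOrder {p} {q} b count (suc j) i = begin
  Walk (downUp i ++ up ∷ down ∷ upDown j) p q
    ↔⟨ Walk-++-⊎ (downUp i) (λ _ → Walk-up-down (upDown j)) ⟩
  (Walk (downUp i ++ down ∷ up ∷ upDown j) p q ⊎ Walk (downUp i ++ upDown j) p q)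
    ≡⟨ cong (λ w → Walk w p q ⊎ Walk (downUp i ++ upDown j) p q) (downUp-++ i (upDown j)) ⟩
  (Walk (downUp (suc i) ++ upDown j) p q ⊎ Walk (downUp i ++ upDown j) p q)
    ↔⟨ Walk-normalOrder b count j (suc i) ⊎-↔ Walk-normalOrder b count j i ⟩
  (Fin (binomialTransform b j (suc i)) ⊎ Fin (binomialTransform b j i))
    ↔⟨ +↔⊎ ⟨
  Fin (binomialTransform b (suc j) i)
    ∎
  where open EquationalReasoning {k = bijection}

-- Stirling number identities

binomialTransform-shift : ∀ b j i → binomialTransform b j (suc i) ≡ binomialTransform (λ t → b (suc t)) j i
binomialTransform-shift b zero    i = refl
binomialTransform-shift b (suc j) i = cong₂ _+_ (binomialTransform-shift b j (suc i)) (binomialTransform-shift b j i)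

binomialTransform-+ : ∀ f g j i →
  binomialTransform (λ t → f t + g t) j i ≡ binomialTransform f j i + binomialTransform g j i
binomialTransform-+ f g zero    i = refl
binomialTransform-+ f g (suc j) i =
  trans (cong₂ _+_ (binomialTransform-+ f g j (suc i)) (binomialTransform-+ f g j i))
        (interchange +-commutativeSemigroup (binomialTransform f j (suc i)) _ _ _)

binomialTransform-* : ∀ c f j i → binomialTransform (λ t → c * f t) j i ≡ c * binomialTransform f j i
binomialTransform-* c f zero    i = refl
binomialTransform-* c f (suc j) i =
  trans (cong₂ _+_ (binomialTransform-* c f j (suc i)) (binomialTransform-* c f j i)) (sym (*-distribˡ-+ c _ _))

binomialTransform-0 : ∀ j i → binomialTransform (λ _ → 0) j i ≡ 0
binomialTransform-0 zero    i = refl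
binomialTransform-0 (suc j) i = cong₂ _+_ (binomialTransform-0 j (suc i)) (binomialTransform-0 j i)

binomialTransform-S : ∀ j l → binomialTransform (λ t → S t l) j 0 ≡ S (suc j) (suc l)
binomialTransform-S zero    l = sym (cong (_+ S 0 l) (*-zeroʳ l))
binomialTransform-S (suc j) zero = begin
  binomialTransform (λ t → S t 0) j 1 + binomialTransform (λ t → S t 0) j 0
    ≡⟨ cong₂ _+_ (trans (binomialTransform-shift (λ t → S t 0) j 0) (binomialTransform-0 j 0)) (binomialTransform-S j 0) ⟩
  S (suc j) 1
    ≡⟨ sym (trans (+-identityʳ _) (*-identityˡ _)) ⟩
  1 * S (suc j) 1 + 0
    ∎
  where open ≡-Reasoning
binomialTransform-S (suc j) (suc l) = begin
  σ (suc l) 1 + σ (suc l) 0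
    ≡⟨ cong (_+ σ (suc l) 0) (binomialTransform-shift (λ t → S t (suc l)) j 0) ⟩
  binomialTransform (λ t → suc l * S t (suc l) + S t l) j 0 + σ (suc l) 0
    ≡⟨ cong (_+ σ (suc l) 0) (binomialTransform-+ (λ t → suc l * S t (suc l)) (λ t → S t l) j 0) ⟩
  binomialTransform (λ t → suc l * S t (suc l)) j 0 + σ l 0 + σ (suc l) 0
    ≡⟨ cong (λ a → a + σ l 0 + σ (suc l) 0) (binomialTransform-* (suc l) (λ t → S t (suc l)) j 0) ⟩
  suc l * σ (suc l) 0 + σ l 0 + σ (suc l) 0
    ≡⟨ cong₂ (λ a b → suc l * a + b + a) (binomialTransform-S j (suc l)) (binomialTransform-S j l) ⟩
  suc l * S (suc j) (suc (suc l)) + S (suc j) (suc l) + S (suc j) (suc (suc l))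
    ≡⟨ recurrence (suc l) (S (suc j) (suc (suc l))) (S (suc j) (suc l)) ⟩
  suc (suc l) * S (suc j) (suc (suc l)) + S (suc j) (suc l)
    ∎
  where
  open ≡-Reasoning
  σ : ℕ → ℕ → ℕ
  σ l = binomialTransform (λ t → S t l) j
  recurrence : ∀ c x y → c * x + y + x ≡ suc c * x + y
  recurrence = solve-∀

-- rowCount m k = m^{(m)}_{(m)}(k)
rowCount : ℕ → ℕ → ℕ
rowCount zero    k = S k 0
rowCount (suc m) k = rowCount m k + S k (suc m)

rowCount-0 : ∀ m → rowCount m 0 ≡ 1
rowCount-0 zero    = refl
rowCount-0 (suc m) = trans (+-identityʳ _) (rowCount-0 m)

binomialTransform-rowCount : ∀ m k → binomialTransform (rowCount m) k 0 ≡ rowCount (suc m) (suc k)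
binomialTransform-rowCount zero    k = binomialTransform-S k 0
binomialTransform-rowCount (suc m) k =
  trans (binomialTransform-+ (rowCount m) (λ t → S t (suc m)) k 0)
        (cong₂ _+_ (binomialTransform-rowCount m k) (binomialTransform-S k (suc m)))

-- rowHookCount j k = m^{(j+1)}_{(j,1)}(k)
rowHookCount : ℕ → ℕ → ℕ
rowHookCount j k = sum1to j (λ l → l * S k l) + j * S k (suc j)

rowCount-suc : ∀ j k → rowCount (suc j) (suc k) ≡ rowCount (suc j) k + rowHookCount j k
rowCount-suc zero    k = identity (S k 1) (S k 0)
  where
  identity : ∀ a b → 1 * a + b ≡ b + a + 0
  identity = solve-∀
rowCount-suc (suc j) k = begin
  rowCount (suc j) (suc k) + S (suc k) (suc (suc j))
    ≡⟨ cong (_+ S (suc k) (suc (suc j))) (rowCount-suc j k) ⟩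
  rowCount (suc j) k + (a + j * y) + ((2 + j) * x + y)
    ≡⟨ identity (rowCount (suc j) k) a j y x ⟩
  rowCount (suc j) k + x + (a + (1 + j) * y + (1 + j) * x)
    ∎
  where
  open ≡-Reasoning
  a = sum1to j (λ l → l * S k l)
  x = S k (suc (suc j))
  y = S k (suc j)
  identity : ∀ n a j y x → n + (a + j * y) + ((2 + j) * x + y) ≡ n + x + (a + (1 + j) * y + (1 + j) * x)
  identity = solve-∀

sum-l*S-suc : ∀ m k → sum1to (suc m) (λ l → l * S (suc (suc k)) l)
                      ≡ sum1to (suc m) (λ l → l * l * S (suc k) l) + sum1to m (λ l → l * S (suc k) l) + sum1to m (S (suc k))
sum-l*S-suc zero    k = identity (S (suc k) 1)
  where
  identity : ∀ a → 0 + 1 * (1 * a + 0) ≡ 0 + 1 * 1 * a + 0 + 0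
  identity = solve-∀
sum-l*S-suc (suc m) k = begin
  sum1to (suc m) (λ l → l * S (suc (suc k)) l) + (2 + m) * ((2 + m) * x + y)
    ≡⟨ cong (_+ (2 + m) * ((2 + m) * x + y)) (sum-l*S-suc m k) ⟩
  q + b + z + (2 + m) * ((2 + m) * x + y)
    ≡⟨ identity q b z m x y ⟩
  (q + (2 + m) * (2 + m) * x) + (b + (1 + m) * y) + (z + y)
    ∎
  where
  open ≡-Reasoning
  q = sum1to (suc m) (λ l → l * l * S (suc k) l)
  b = sum1to m (λ l → l * S (suc k) l)
  z = sum1to m (S (suc k))
  x = S (suc k) (suc (suc m))
  y = S (suc k) (suc m)
  identity : ∀ q b z m x y → q + b + z + (2 + m) * ((2 + m) * x + y)
                             ≡ q + (2 + m) * (2 + m) * x + (b + (1 + m) * y) + (z + y)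
  identity = solve-∀

rowHookCount-suc : ∀ m k → rowHookCount (suc m) (suc (suc k)) ≡ rowHookCount (suc m) (suc k) + lhs (suc (suc m)) (suc k)
rowHookCount-suc m k = begin
  sum1to (suc m) (λ l → l * S (suc (suc k)) l) + (1 + m) * ((2 + m) * x + y)
    ≡⟨ cong (_+ (1 + m) * ((2 + m) * x + y)) (sum-l*S-suc m k) ⟩
  q + b + z + (1 + m) * ((2 + m) * x + y)
    ≡⟨ identity q b z m x y ⟩
  (b + (1 + m) * y + (1 + m) * x) + (z + q + (1 + m) * (1 + m) * x)
    ∎
  where
  open ≡-Reasoning
  q = sum1to (suc m) (λ l → l * l * S (suc k) l)
  b = sum1to m (λ l → l * S (suc k) l)
  z = sum1to m (S (suc k))
  x = S (suc k) (suc (suc m))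
  y = S (suc k) (suc m)
  identity : ∀ q b z m x y → q + b + z + (1 + m) * ((2 + m) * x + y)
                             ≡ b + (1 + m) * y + (1 + m) * x + (z + q + (1 + m) * (1 + m) * x)
  identity = solve-∀

-- Walks between one-row and hook partitions

row : ℕ → Partition
row zero    = [] , [] , []
row (suc m) = suc m ∷ [] , [-] , s≤s z≤n ∷ []

row-⋖ₚ : ∀ m → row m ⋖ₚ row (suc m)
row-⋖ₚ zero    = new-row
row-⋖ₚ (suc m) = here

⋖ₚ-row : ∀ {m} t → t ⋖ₚ row (suc m) → t ≡ row m
⋖ₚ-row {zero}  ((_ ∷ _) , _ , () ∷ _) here
⋖ₚ-row {suc m} _                      here    = Partition-≡ refl
⋖ₚ-row {zero}  _                      new-row = Partition-≡ refl

Σ-below-row : ∀ {m} {X : Partition → Set} → Σ Partition (λ t → t ⋖ₚ row (suc m) × X t) ↔ X (row m)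
Σ-below-row {m} = Σ-unique Partition-UIP (λ _ → ⋖ʳ-irrelevant) ⋖ₚ-row (row-⋖ₚ m)

Walk-up : ∀ {p q} → Walk (up ∷ []) p q ↔ (p ⋖ₚ q)
Walk-up {p} {q} =
  ↔-trans (Σ-congˡ λ {r} → ×-comm (p ⋖ₚ r) (r ≡ q)) (Σ-unique Partition-UIP (λ _ → Partition-UIP) (λ _ e → e) refl)

Walk-++-up-row : ∀ w {p m} → Walk (w ++ up ∷ []) p (row (suc m)) ↔ Walk w p (row m)
Walk-++-up-row w {p} {m} = begin
  Walk (w ++ up ∷ []) p (row (suc m))                         ↔⟨ Walk-++ w ⟩
  Σ Partition (λ r → Walk w p r × Walk (up ∷ []) r (row (suc m)))
    ↔⟨ Σ-congˡ (λ {r} → ↔-refl ×-↔ ↔-trans (Walk-up {r}) (last-step r)) ⟩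
  Σ Partition (λ r → Walk w p r × row m ≡ r)                  ↔⟨ Σ-congˡ (λ {r} → ×-comm (Walk w p r) _) ⟩
  Σ Partition (λ r → row m ≡ r × Walk w p r)                  ↔⟨ Σ-≡-contract ⟩
  Walk w p (row m)                                            ∎
  where
  open EquationalReasoning {k = bijection}
  last-step : ∀ r → (r ⋖ₚ row (suc m)) ↔ (row m ≡ r)
  last-step r = Irrelevant-↔ ⋖ʳ-irrelevant Partition-UIP (λ c → sym (⋖ₚ-row r c)) (λ { refl → row-⋖ₚ m })

≡-refl↔Fin1 : {p : Partition} → (p ≡ p) ↔ Fin 1
≡-refl↔Fin1 = ↔-trans (Irrelevant-↔ Partition-UIP (λ _ _ → refl) _ (λ _ → refl)) (↔-sym 1↔⊤)

Walk-row : ∀ n k → Walk (downUp k) (row n) (row n) ↔ Fin (rowCount n k)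
Walk-row zero    zero    = ≡-refl↔Fin1
Walk-row zero    (suc k) = mk↔ₛ′ (λ { (_ , () , _) }) (λ ()) (λ ()) (λ { (_ , () , _) })
Walk-row (suc m) zero    = subst (λ c → (row (suc m) ≡ row (suc m)) ↔ Fin c) (sym (rowCount-0 (suc m))) ≡-refl↔Fin1
Walk-row (suc m) (suc k) = begin
  Walk (down ∷ up ∷ downUp k) (row (suc m)) (row (suc m))
    ≡⟨ cong (λ w → Walk (down ∷ w) (row (suc m)) (row (suc m))) (sym (upDown-++-up k)) ⟩
  Walk (down ∷ upDown k ++ up ∷ []) (row (suc m)) (row (suc m))   ↔⟨ Σ-below-row ⟩
  Walk (upDown k ++ up ∷ []) (row m) (row (suc m))                ↔⟨ Walk-++-up-row (upDown k) ⟩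
  Walk (upDown k) (row m) (row m)                                 ↔⟨ Walk-normalOrder (rowCount m) (Walk-row m) k 0 ⟩
  Fin (binomialTransform (rowCount m) k 0)                        ≡⟨ cong Fin (binomialTransform-rowCount m k) ⟩
  Fin (rowCount (suc m) (suc k))                                  ∎
  where open EquationalReasoning {k = bijection}

hook⁺ : ℕ → Partition
hook⁺ m = hook (suc (suc m)) (s≤s (s≤s z≤n))

row-⋖ₚ↔ : ∀ m r → (row (suc m) ⋖ₚ r) ↔ (row (suc (suc m)) ≡ r ⊎ hook⁺ m ≡ r)
row-⋖ₚ↔ m r = Irrelevant-↔ ⋖ʳ-irrelevant irrelevant to from
  where
  irrelevant : Irrelevant (row (suc (suc m)) ≡ r ⊎ hook⁺ m ≡ r)
  irrelevant (inj₁ e) (inj₁ e′) = cong inj₁ (Partition-UIP e e′)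
  irrelevant (inj₂ e) (inj₂ e′) = cong inj₂ (Partition-UIP e e′)
  irrelevant (inj₁ refl) (inj₂ ())
  irrelevant (inj₂ refl) (inj₁ ())
  to : row (suc m) ⋖ₚ r → row (suc (suc m)) ≡ r ⊎ hook⁺ m ≡ r
  to here            = inj₁ (Partition-≡ refl)
  to (there new-row) = inj₂ (Partition-≡ refl)
  from : row (suc (suc m)) ≡ r ⊎ hook⁺ m ≡ r → row (suc m) ⋖ₚ r
  from (inj₁ refl) = here
  from (inj₂ refl) = there new-row

Σ-above-row : ∀ {m} {X : Partition → Set} →
              Σ Partition (λ r → row (suc m) ⋖ₚ r × X r) ↔ (X (row (suc (suc m))) ⊎ X (hook⁺ m))
Σ-above-row {m} {X} = begin
  Σ Partition (λ r → row (suc m) ⋖ₚ r × X r)                          ↔⟨ Σ-congˡ (λ {r} → row-⋖ₚ↔ m r ×-↔ ↔-refl) ⟩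
  Σ Partition (λ r → (row (suc (suc m)) ≡ r ⊎ hook⁺ m ≡ r) × X r)     ↔⟨ Σ-congˡ ×-distribʳ-⊎ ⟩
  Σ Partition (λ r → row (suc (suc m)) ≡ r × X r ⊎ hook⁺ m ≡ r × X r) ↔⟨ Σ-distribˡ-⊎ ⟩
  (Σ Partition (λ r → row (suc (suc m)) ≡ r × X r) ⊎ Σ Partition (λ r → hook⁺ m ≡ r × X r))
                                                                      ↔⟨ Σ-≡-contract ⊎-↔ Σ-≡-contract ⟩
  (X (row (suc (suc m))) ⊎ X (hook⁺ m))                               ∎
  where open EquationalReasoning {k = bijection}

downUp-suc : ∀ k → downUp (suc k) ≡ downUp k ++ down ∷ up ∷ []
downUp-suc k = sym (trans (downUp-++ k []) (cong (λ w → down ∷ up ∷ w) (++-identityʳ (downUp k))))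

module _ (m : ℕ) where

  private
    R h : Partition
    R = row (suc (suc m))
    h = hook⁺ m

  Walk-row-row-suc : ∀ k → Walk (downUp (suc k)) R R ↔ (Walk (downUp k) R R ⊎ Walk (downUp k) R h)
  Walk-row-row-suc k = begin
    Walk (downUp (suc k)) R R                                      ≡⟨ cong (λ w → Walk w R R) (downUp-suc k) ⟩
    Walk (downUp k ++ down ∷ up ∷ []) R R                          ↔⟨ Walk-++ (downUp k) ⟩
    Σ Partition (λ r → Walk (downUp k) R r × Walk (down ∷ up ∷ []) r R)
      ↔⟨ Σ-congˡ (λ {r} → ↔-refl ×-↔ last-two-steps r) ⟩
    Σ Partition (λ r → Walk (downUp k) R r × row (suc m) ⋖ₚ r)     ↔⟨ Σ-congˡ (λ {r} → ×-comm (Walk (downUp k) R r) _) ⟩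
    Σ Partition (λ r → row (suc m) ⋖ₚ r × Walk (downUp k) R r)     ↔⟨ Σ-above-row ⟩
    (Walk (downUp k) R R ⊎ Walk (downUp k) R h)                    ∎
    where
    open EquationalReasoning {k = bijection}
    last-two-steps : ∀ r → Walk (down ∷ up ∷ []) r R ↔ (row (suc m) ⋖ₚ r)
    last-two-steps r = begin
      Σ Partition (λ t → t ⋖ₚ r × Walk (up ∷ []) t R)  ↔⟨ Σ-congˡ (λ {t} → ↔-refl ×-↔ Walk-up {t}) ⟩
      Σ Partition (λ t → t ⋖ₚ r × t ⋖ₚ R)              ↔⟨ Σ-congˡ (λ {t} → ×-comm (t ⋖ₚ r) _) ⟩
      Σ Partition (λ t → t ⋖ₚ R × t ⋖ₚ r)              ↔⟨ Σ-below-row ⟩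
      row (suc m) ⋖ₚ r                                 ∎

  Walk-row-hook-suc : ∀ k → Walk (downUp (suc k)) R h ↔ (Walk (downUp k) R h ⊎ Walk (downUp k) h h)
  Walk-row-hook-suc k = ↔-trans Σ-below-row Σ-above-row

  Walk-row-hook : ∀ k → Walk (downUp k) R h ↔ Fin (rowHookCount (suc m) k)
  Walk-row-hook k = Fin-+-cancelˡ (rowCount (suc (suc m)) k) (rowHookCount (suc m) k) (begin
    (Fin (rowCount (suc (suc m)) k) ⊎ Walk (downUp k) R h)  ↔⟨ Walk-row (suc (suc m)) k ⊎-↔ ↔-refl ⟨
    (Walk (downUp k) R R ⊎ Walk (downUp k) R h)             ↔⟨ Walk-row-row-suc k ⟨
    Walk (downUp (suc k)) R R                               ↔⟨ Walk-row (suc (suc m)) (suc k) ⟩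
    Fin (rowCount (suc (suc m)) (suc k))                    ≡⟨ cong Fin (rowCount-suc (suc m) k) ⟩
    Fin (rowCount (suc (suc m)) k + rowHookCount (suc m) k) ∎)
    where open EquationalReasoning {k = bijection}

  Walk-hook-hook : ∀ k → Walk (downUp (suc k)) h h ↔ Fin (lhs (suc (suc m)) (suc k))
  Walk-hook-hook k = Fin-+-cancelˡ (rowHookCount (suc m) (suc k)) (lhs (suc (suc m)) (suc k)) (begin
    (Fin (rowHookCount (suc m) (suc k)) ⊎ Walk (downUp (suc k)) h h)  ↔⟨ Walk-row-hook (suc k) ⊎-↔ ↔-refl ⟨
    (Walk (downUp (suc k)) R h ⊎ Walk (downUp (suc k)) h h)          ↔⟨ Walk-row-hook-suc (suc k) ⟨
    Walk (downUp (suc (suc k))) R h                                  ↔⟨ Walk-row-hook (suc (suc k)) ⟩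
    Fin (rowHookCount (suc m) (suc (suc k)))                         ≡⟨ cong Fin (rowHookCount-suc m k) ⟩
    Fin (rowHookCount (suc m) (suc k) + lhs (suc (suc m)) (suc k))   ∎)
    where open EquationalReasoning {k = bijection}

mainTheorem3 : (n k : ℕ) (hn : 2 ≤ n) → 1 ≤ k →
    Fin (lhs n k) ↔ VT k (hook n hn) (hook n hn)
mainTheorem3 (suc (suc m)) (suc k) (s≤s (s≤s z≤n)) (s≤s z≤n) =
  ↔-sym (↔-trans (VT↔Walk (suc k) {hook⁺ m} {hook⁺ m}) (Walk-hook-hook m k))
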